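{- Let $p>3$ be a prime and let $m$ be an odd integer with $0<m<p-1$. Then \[ \sum_{k=1}^{p-1}k^mH_k^2\equiv B_{m-1}\pmod p. \]
   Context: $H_n=\sum_{i=1}^n 1/i$ are the harmonic numbers. $B_0,B_1,B_2,\dots$ are the Bernoulli numbers defined by $B_0=1$ and $\sum_{k=0}^n\binom{n+1}{k}B_k=0$ for $n\ge1$ (so $B_1=-1/2$). For rationals $a,b$ whose denominators are coprime to $p$, $a\equiv b\pmod{p}$ means that $a-b$, written in lowest terms, has numerator divisible by $p$. -}

module Defs where

open import Data.Nat as ℕ using (ℕ; zero; suc)
open import Data.Nat.Divisibility using (_∣_)
open import Data.Nat.Combinatorics using (_C_)
open import Data.Integer as ℤ using (ℤ; +_)
open import Data.Rational as ℚ using (ℚ; 0ℚ; 1ℚ; _+_; _*_; _-_; -_; ↥_)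
open import Data.List using (List; []; _∷_)

sum1 : ℕ → (ℕ → ℚ) → ℚ
sum1 zero    f = 0ℚ
sum1 (suc n) f = sum1 n f + f (suc n)

inv-suc : ℕ → ℚ
inv-suc k = (+ 1) ℚ./ suc k

H : ℕ → ℚ
H zero    = 0ℚ
H (suc n) = H n + inv-suc n

_^ℚ_ : ℚ → ℕ → ℚ
q ^ℚ zero  = 1ℚ
q ^ℚ suc n = q * (q ^ℚ n)

ℕtoℚ : ℕ → ℚ
ℕtoℚ n = (+ n) ℚ./ 1

-- Bernoulli numbers.  bernoulliList n = [B_0, B_1, ..., B_{n-1}] (in order),
-- built by the recurrence Σ_{k=0}^{n} C(n+1,k) B_k = 0 (n ≥ 1), B_0 = 1, i.e.
-- B_n = -(1/(n+1)) Σ_{k=0}^{n-1} C(n+1,k) B_k.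

binSum : ℕ → ℕ → List ℚ → ℚ
binSum N k []       = 0ℚ
binSum N k (b ∷ bs) = ℕtoℚ (N C k) * b + binSum N (suc k) bs

snoc : List ℚ → ℚ → List ℚ
snoc []       y = y ∷ []
snoc (x ∷ xs) y = x ∷ snoc xs y

bernoulliList : ℕ → List ℚ
bernoulliList zero          = []
bernoulliList (suc zero)    = 1ℚ ∷ []
bernoulliList (suc (suc n)) =
  let bs = bernoulliList (suc n)
  in snoc bs (- (inv-suc (suc n) * binSum (suc (suc n)) 0 bs))

last : List ℚ → ℚ
last []           = 0ℚ
last (x ∷ [])     = x
last (x ∷ y ∷ ys) = last (y ∷ ys)

B : ℕ → ℚ
B n = last (bernoulliList (suc n))

_≡_[modℚ_] : ℚ → ℚ → ℕ → Set
a ≡ b [modℚ p ] = p ∣ ℤ.∣ ↥ (a - b) ∣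

module Submission where

-- HarmonicCongruences derives, from 1/a + 1/b ≡ 0 for a + b = p, that H_N ≡ 0 and
-- H_{N-k} ≡ H_k; from the uniqueness lemma, that Σ_j j^e ≡ 0 for 1 ≤ e < N and, via Abel
-- summation, Σ_j j^s H_j ≡ B_s for s < N.  For the target sum U, substituting k ↦ p - k
-- and expanding H_{k-1} = H_k - 1/k gives U ≡ 2 Σ k^{m-1} H_k - Σ k^{m-1}/k - U, where the
-- middle sum vanishes; so 2U ≡ 2B_{m-1}, and 2 is invertible.

open import Defs

module HarmonicSquareSums where

  open import Data.Nat as ℕ using (ℕ; zero; suc; _∸_; z≤n; s≤s)
  import Data.Nat.Properties as ℕP
  import Data.Nat.Divisibility as ℕD
  open ℕD using (_∣_)
  open import Data.Nat.Primality using (Prime; euclidsLemma; ¬prime[1])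
  import Data.Nat.Coprimality as Coprime
  open import Data.Nat.Combinatorics
    using (_C_; nCk+nC[k+1]≡[n+1]C[k+1]; nCn≡1; nC1≡n; nCk≡nC[n∸k]; k>n⇒nCk≡0)
  import Data.Integer as ℤ
  import Data.Integer.Properties as ℤP
  import Data.Integer.Divisibility.Signed as ℤS
  import Data.Integer.Solver
  open import Data.Rational as ℚ using (ℚ; 0ℚ; 1ℚ; _+_; _*_; _-_; -_; ↥_; ↧_; ↧ₙ_)
  import Data.Rational.Properties as ℚP
  import Data.Rational.Unnormalised as ℚᵘ
  import Data.Rational.Unnormalised.Properties as ℚᵘP
  open import Data.Rational.Solver using (module +-*-Solver)
  open import Data.List using ([]; _∷_; length)
  open import Data.Product using (_,_)
  open import Data.Sum using (_⊎_; inj₁; inj₂)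
  open import Data.Empty using (⊥-elim)
  open import Relation.Nullary using (¬_)
  open import Relation.Binary.PropositionalEquality

  open +-*-Solver using (solve; _:+_; _:*_; _:-_; _:=_; con; :-_)

  -- Finite sums

  -- Σ_{i<n} f i; binomial expansions are indexed from 0, whereas Defs.sum1 n f
  -- is Σ_{1≤i≤n} f i.
  sum0 : ℕ → (ℕ → ℚ) → ℚ
  sum0 zero    f = 0ℚ
  sum0 (suc n) f = sum0 n f + f n

  sum0-cong : ∀ n {f g : ℕ → ℚ} → (∀ i → i ℕ.< n → f i ≡ g i) → sum0 n f ≡ sum0 n g
  sum0-cong zero    eq = refl
  sum0-cong (suc n) eq = cong₂ _+_ (sum0-cong n (λ i i<n → eq i (ℕP.m<n⇒m<1+n i<n))) (eq n ℕP.≤-refl)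

  sum1-cong : ∀ n {f g : ℕ → ℚ} → (∀ i → i ℕ.< n → f (suc i) ≡ g (suc i)) → sum1 n f ≡ sum1 n g
  sum1-cong zero    eq = refl
  sum1-cong (suc n) eq = cong₂ _+_ (sum1-cong n (λ i i<n → eq i (ℕP.m<n⇒m<1+n i<n))) (eq n ℕP.≤-refl)

  +-interchange : ∀ a b x y → (a + x) + (b + y) ≡ (a + b) + (x + y)
  +-interchange = solve 4 (λ a b x y → (a :+ x) :+ (b :+ y) := (a :+ b) :+ (x :+ y)) refl

  +--interchange : ∀ a b x y → (a + x) - (b + y) ≡ (a - b) + (x - y)
  +--interchange = solve 4 (λ a b x y → (a :+ x) :- (b :+ y) := (a :- b) :+ (x :- y)) refl

  sum0-+ : ∀ n (f g : ℕ → ℚ) → sum0 n (λ i → f i + g i) ≡ sum0 n f + sum0 n g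
  sum0-+ zero    f g = sym (ℚP.+-identityˡ 0ℚ)
  sum0-+ (suc n) f g = trans (cong (_+ (f n + g n)) (sum0-+ n f g))
                             (sym (+-interchange (sum0 n f) (sum0 n g) (f n) (g n)))

  sum0-- : ∀ n (f g : ℕ → ℚ) → sum0 n (λ i → f i - g i) ≡ sum0 n f - sum0 n g
  sum0-- zero    f g = refl
  sum0-- (suc n) f g = trans (cong (_+ (f n - g n)) (sum0-- n f g))
                             (sym (+--interchange (sum0 n f) (sum0 n g) (f n) (g n)))

  sum1-+ : ∀ n (f g : ℕ → ℚ) → sum1 n (λ i → f i + g i) ≡ sum1 n f + sum1 n g
  sum1-+ zero    f g = sym (ℚP.+-identityˡ 0ℚ)
  sum1-+ (suc n) f g = trans (cong (_+ (f (suc n) + g (suc n))) (sum1-+ n f g))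
                             (sym (+-interchange (sum1 n f) (sum1 n g) (f (suc n)) (g (suc n))))

  sum1-- : ∀ n (f g : ℕ → ℚ) → sum1 n (λ i → f i - g i) ≡ sum1 n f - sum1 n g
  sum1-- zero    f g = refl
  sum1-- (suc n) f g = trans (cong (_+ (f (suc n) - g (suc n))) (sum1-- n f g))
                             (sym (+--interchange (sum1 n f) (sum1 n g) (f (suc n)) (g (suc n))))

  sum0-*ˡ : ∀ n c (f : ℕ → ℚ) → c * sum0 n f ≡ sum0 n (λ i → c * f i)
  sum0-*ˡ zero    c f = ℚP.*-zeroʳ c
  sum0-*ˡ (suc n) c f = trans (ℚP.*-distribˡ-+ c (sum0 n f) (f n)) (cong (_+ c * f n) (sum0-*ˡ n c f))

  sum0-*ʳ : ∀ n c (f : ℕ → ℚ) → sum0 n f * c ≡ sum0 n (λ i → f i * c)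
  sum0-*ʳ zero    c f = ℚP.*-zeroˡ c
  sum0-*ʳ (suc n) c f = trans (ℚP.*-distribʳ-+ c (sum0 n f) (f n)) (cong (_+ f n * c) (sum0-*ʳ n c f))

  sum1-*ˡ : ∀ n c (f : ℕ → ℚ) → c * sum1 n f ≡ sum1 n (λ i → c * f i)
  sum1-*ˡ zero    c f = ℚP.*-zeroʳ c
  sum1-*ˡ (suc n) c f = trans (ℚP.*-distribˡ-+ c (sum1 n f) (f (suc n)))
                              (cong (_+ c * f (suc n)) (sum1-*ˡ n c f))

  sum1-zero : ∀ n → sum1 n (λ _ → 0ℚ) ≡ 0ℚ
  sum1-zero zero    = refl
  sum1-zero (suc n) = trans (ℚP.+-identityʳ _) (sum1-zero n)

  sum0-sum1-swap : ∀ a b (F : ℕ → ℕ → ℚ) →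
    sum0 a (λ k → sum1 b (F k)) ≡ sum1 b (λ j → sum0 a (λ k → F k j))
  sum0-sum1-swap zero    b F = sym (sum1-zero b)
  sum0-sum1-swap (suc a) b F = trans (cong (_+ sum1 b (F a)) (sum0-sum1-swap a b F))
                                     (sym (sum1-+ b (λ j → sum0 a (λ k → F k j)) (F a)))

  sum0-first : ∀ n (f : ℕ → ℚ) → sum0 (suc n) f ≡ f 0 + sum0 n (λ k → f (suc k))
  sum0-first zero    f = trans (ℚP.+-identityˡ (f 0)) (sym (ℚP.+-identityʳ (f 0)))
  sum0-first (suc n) f = trans (cong (_+ f (suc n)) (sum0-first n f))
                               (ℚP.+-assoc (f 0) (sum0 n (λ k → f (suc k))) (f (suc n)))

  sum1-first : ∀ n (f : ℕ → ℚ) → sum1 (suc n) f ≡ f 1 + sum1 n (λ i → f (suc i))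
  sum1-first zero    f = trans (ℚP.+-identityˡ (f 1)) (sym (ℚP.+-identityʳ (f 1)))
  sum1-first (suc n) f = trans (cong (_+ f (suc (suc n))) (sum1-first n f))
                               (ℚP.+-assoc (f 1) (sum1 n (λ i → f (suc i))) (f (suc (suc n))))

  sum1-reflect : ∀ n (f : ℕ → ℚ) → sum1 n f ≡ sum1 n (λ i → f (suc n ∸ i))
  sum1-reflect zero    f = refl
  sum1-reflect (suc n) f = begin
    sum1 n f + f (suc n)                       ≡⟨ ℚP.+-comm (sum1 n f) (f (suc n)) ⟩
    f (suc n) + sum1 n f                       ≡⟨ cong (λ z → f (suc n) + z) (sum1-reflect n f) ⟩
    f (suc n) + sum1 n (λ i → f (suc n ∸ i))   ≡⟨ sym (sum1-first n (λ i → f (suc (suc n) ∸ i))) ⟩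
    sum1 (suc n) (λ i → f (suc (suc n) ∸ i))   ∎
    where open ≡-Reasoning

  sum1-telescope : ∀ n (a : ℕ → ℚ) → sum1 n (λ j → a (suc j) - a j) ≡ a (suc n) - a 1
  sum1-telescope zero    a = sym (ℚP.+-inverseʳ (a 1))
  sum1-telescope (suc n) a =
    trans (cong (_+ (a (suc (suc n)) - a (suc n))) (sum1-telescope n a))
          (solve 3 (λ x y z → (y :- x) :+ (z :- y) := z :- x) refl (a 1) (a (suc n)) (a (suc (suc n))))

  sum1-abel : ∀ n (a b : ℕ → ℚ) → b 0 ≡ 0ℚ →
    sum1 n (λ j → (a (suc j) - a j) * b j) ≡ a (suc n) * b n - sum1 n (λ j → a j * (b j - b (j ∸ 1)))
  sum1-abel zero    a b b0≡0 = begin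
    0ℚ              ≡⟨ solve 1 (λ x → con 0ℚ := x :* con 0ℚ :- con 0ℚ) refl (a 1) ⟩
    a 1 * 0ℚ - 0ℚ   ≡⟨ cong (λ z → a 1 * z - 0ℚ) (sym b0≡0) ⟩
    a 1 * b 0 - 0ℚ  ∎
    where open ≡-Reasoning
  sum1-abel (suc n) a b b0≡0 =
    trans (cong (_+ (a (suc (suc n)) - a (suc n)) * b (suc n)) (sum1-abel n a b b0≡0))
          (step (a (suc n)) (b n) (sum1 n (λ j → a j * (b j - b (j ∸ 1)))) (a (suc (suc n))) (b (suc n)))
    where
    step : ∀ A B S C D → (A * B - S) + (C - A) * D ≡ C * D - (S + A * (D - B))
    step = solve 5 (λ A B S C D → (A :* B :- S) :+ (C :- A) :* D := C :* D :- (S :+ A :* (D :- B))) refl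

  ι : ℕ → ℚ
  ι = ℕtoℚ

  ι-suc : ∀ n → ι (suc n) ≡ 1ℚ + ι n
  ι-suc n = ℚP.toℚᵘ-injective (ℚᵘP.≃-trans (toℚᵘ-ι (suc n)) (ℚᵘP.≃-trans unnormalised
     (ℚᵘP.≃-sym (ℚᵘP.≃-trans (ℚP.toℚᵘ-homo-+ 1ℚ (ι n)) (ℚᵘP.+-cong (toℚᵘ-ι 1) (toℚᵘ-ι n))))))
    where
    ιᵘ : ℕ → ℚᵘ.ℚᵘ
    ιᵘ k = ℚᵘ.mkℚᵘ (ℤ.+ k) 0
    toℚᵘ-ι : ∀ k → ℚ.toℚᵘ (ι k) ℚᵘ.≃ ιᵘ k
    toℚᵘ-ι k = ℚP.toℚᵘ-fromℚᵘ (ιᵘ k)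
    open Data.Integer.Solver.+-*-Solver renaming (solve to solveℤ; _:+_ to _⊕_; _:*_ to _⊛_; _:=_ to _≐_; con to conℤ)
    unnormalised : ιᵘ (suc n) ℚᵘ.≃ ιᵘ 1 ℚᵘ.+ ιᵘ n
    unnormalised = ℚᵘ.*≡* (solveℤ 1 (λ x → (conℤ (ℤ.+ 1) ⊕ x) ⊛ (conℤ (ℤ.+ 1) ⊛ conℤ (ℤ.+ 1))
                                         ≐ (conℤ (ℤ.+ 1) ⊛ conℤ (ℤ.+ 1) ⊕ x ⊛ conℤ (ℤ.+ 1)) ⊛ conℤ (ℤ.+ 1)) refl (ℤ.+ n))

  ι-+ : ∀ a b → ι (a ℕ.+ b) ≡ ι a + ι b
  ι-+ zero    b = sym (ℚP.+-identityˡ (ι b))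
  ι-+ (suc a) b = begin
    ι (suc (a ℕ.+ b))   ≡⟨ ι-suc (a ℕ.+ b) ⟩
    1ℚ + ι (a ℕ.+ b)    ≡⟨ cong (λ z → 1ℚ + z) (ι-+ a b) ⟩
    1ℚ + (ι a + ι b)    ≡⟨ sym (ℚP.+-assoc 1ℚ (ι a) (ι b)) ⟩
    (1ℚ + ι a) + ι b    ≡⟨ cong (_+ ι b) (sym (ι-suc a)) ⟩
    ι (suc a) + ι b     ∎
    where open ≡-Reasoning

  ι-suc*inv-suc : ∀ k → ι (suc k) * inv-suc k ≡ 1ℚ
  ι-suc*inv-suc k = ℚP.toℚᵘ-injective (ℚᵘP.≃-trans (ℚP.toℚᵘ-homo-* (ι (suc k)) (inv-suc k))
     (ℚᵘP.≃-trans (ℚᵘP.*-cong (ℚP.toℚᵘ-fromℚᵘ (ιᵘ (suc k))) (ℚP.toℚᵘ-fromℚᵘ (ℚᵘ.mkℚᵘ (ℤ.+ 1) k)))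
     (ℚᵘP.≃-trans unnormalised (ℚᵘP.≃-sym (ℚP.toℚᵘ-fromℚᵘ (ιᵘ 1))))))
    where
    ιᵘ : ℕ → ℚᵘ.ℚᵘ
    ιᵘ n = ℚᵘ.mkℚᵘ (ℤ.+ n) 0
    unnormalised : ιᵘ (suc k) ℚᵘ.* ℚᵘ.mkℚᵘ (ℤ.+ 1) k ℚᵘ.≃ ιᵘ 1
    unnormalised = ℚᵘ.*≡* (cong (λ z → ℤ.+ suc z) (trans (trans (ℕP.*-identityʳ _) (ℕP.*-identityʳ k))
                     (sym (trans (ℕP.+-identityʳ _) (ℕP.+-identityʳ k)))))

  ι-suc-cancel : ∀ k x → ι (suc k) * (inv-suc k * x) ≡ x
  ι-suc-cancel k x = begin
    ι (suc k) * (inv-suc k * x)   ≡⟨ sym (ℚP.*-assoc (ι (suc k)) (inv-suc k) x) ⟩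
    ι (suc k) * inv-suc k * x     ≡⟨ cong (_* x) (ι-suc*inv-suc k) ⟩
    1ℚ * x                        ≡⟨ ℚP.*-identityˡ x ⟩
    x                             ∎
    where open ≡-Reasoning

  sum1-one : ∀ n → sum1 n (λ _ → 1ℚ) ≡ ι n
  sum1-one zero    = refl
  sum1-one (suc n) = trans (cong (_+ 1ℚ) (sum1-one n)) (trans (ℚP.+-comm (ι n) 1ℚ) (sym (ι-suc n)))

  -- Powers and the binomial theorem

  pow-+ : ∀ a b x → x ^ℚ (a ℕ.+ b) ≡ x ^ℚ a * x ^ℚ b
  pow-+ zero    b x = sym (ℚP.*-identityˡ (x ^ℚ b))
  pow-+ (suc a) b x = trans (cong (x *_) (pow-+ a b x)) (sym (ℚP.*-assoc x (x ^ℚ a) (x ^ℚ b)))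

  1-pow : ∀ k → 1ℚ ^ℚ k ≡ 1ℚ
  1-pow zero    = refl
  1-pow (suc k) = trans (ℚP.*-identityˡ (1ℚ ^ℚ k)) (1-pow k)

  neg-pow-even : ∀ j x → (- x) ^ℚ (2 ℕ.* j) ≡ x ^ℚ (2 ℕ.* j)
  neg-pow-even zero    x = refl
  neg-pow-even (suc j) x = begin
    (- x) ^ℚ (2 ℕ.* suc j)                  ≡⟨ cong ((- x) ^ℚ_) (ℕP.*-suc 2 j) ⟩
    (- x) ^ℚ (2 ℕ.+ 2 ℕ.* j)                ≡⟨ pow-+ 2 (2 ℕ.* j) (- x) ⟩
    (- x) ^ℚ 2 * (- x) ^ℚ (2 ℕ.* j)         ≡⟨ cong₂ _*_ square (neg-pow-even j x) ⟩
    x ^ℚ 2 * x ^ℚ (2 ℕ.* j)                 ≡⟨ sym (pow-+ 2 (2 ℕ.* j) x) ⟩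
    x ^ℚ (2 ℕ.+ 2 ℕ.* j)                    ≡⟨ cong (x ^ℚ_) (sym (ℕP.*-suc 2 j)) ⟩
    x ^ℚ (2 ℕ.* suc j)                      ∎
    where
    open ≡-Reasoning
    square : (- x) ^ℚ 2 ≡ x ^ℚ 2
    square = solve 1 (λ x → (:- x) :* ((:- x) :* con 1ℚ) := x :* (x :* con 1ℚ)) refl x

  neg-pow-odd : ∀ j x → (- x) ^ℚ suc (2 ℕ.* j) ≡ - (x ^ℚ suc (2 ℕ.* j))
  neg-pow-odd j x = trans (cong ((- x) *_) (neg-pow-even j x)) (sym (ℚP.neg-distribˡ-* x (x ^ℚ (2 ℕ.* j))))

  binomial : ∀ n x → sum0 (suc n) (λ k → ι (n C k) * x ^ℚ k) ≡ (1ℚ + x) ^ℚ n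
  binomial zero    x = refl
  binomial (suc n) x = begin
    sum0 (suc (suc n)) f
      ≡⟨ sum0-first (suc n) f ⟩
    f 0 + sum0 (suc n) (λ k → f (suc k))
      ≡⟨ cong (f 0 +_) shifted ⟩
    f 0 + (x * P + X)
      ≡⟨ solve 3 (λ c X xP → c :+ (xP :+ X) := xP :+ (c :+ X)) refl (f 0) X (x * P) ⟩
    x * P + (f 0 + X)
      ≡⟨ cong (x * P +_) unshifted ⟩
    x * P + (P + 0ℚ)
      ≡⟨ solve 2 (λ P x → x :* P :+ (P :+ con 0ℚ) := (con 1ℚ :+ x) :* P) refl P x ⟩
    (1ℚ + x) * P                            ∎
    where
    open ≡-Reasoning
    f g : ℕ → ℚ
    f k = ι (suc n C k) * x ^ℚ k
    g k = ι (n C k) * x ^ℚ k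
    P = (1ℚ + x) ^ℚ n
    X = sum0 (suc n) (λ k → g (suc k))
    pascal : ∀ k → k ℕ.< suc n → f (suc k) ≡ x * g k + g (suc k)
    pascal k _ = begin
      ι (suc n C suc k) * (x * x ^ℚ k)
        ≡⟨ cong (λ c → ι c * (x * x ^ℚ k)) (sym (nCk+nC[k+1]≡[n+1]C[k+1] n k)) ⟩
      ι (n C k ℕ.+ n C suc k) * (x * x ^ℚ k)
        ≡⟨ cong (_* (x * x ^ℚ k)) (ι-+ (n C k) (n C suc k)) ⟩
      (ι (n C k) + ι (n C suc k)) * (x * x ^ℚ k)
        ≡⟨ solve 4 (λ a b x y → (a :+ b) :* (x :* y) := x :* (a :* y) :+ b :* (x :* y)) refl
                   (ι (n C k)) (ι (n C suc k)) x (x ^ℚ k) ⟩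
      x * g k + g (suc k) ∎
    shifted : sum0 (suc n) (λ k → f (suc k)) ≡ x * P + X
    shifted = begin
      sum0 (suc n) (λ k → f (suc k))                  ≡⟨ sum0-cong (suc n) pascal ⟩
      sum0 (suc n) (λ k → x * g k + g (suc k))        ≡⟨ sum0-+ (suc n) (λ k → x * g k) (λ k → g (suc k)) ⟩
      sum0 (suc n) (λ k → x * g k) + X                ≡⟨ cong (_+ X) (sym (sum0-*ˡ (suc n) x g)) ⟩
      x * sum0 (suc n) g + X                          ≡⟨ cong (λ z → x * z + X) (binomial n x) ⟩
      x * P + X                                       ∎
    unshifted : f 0 + X ≡ P + 0ℚ
    unshifted = begin
      f 0 + X
        ≡⟨ sym (sum0-first (suc n) g) ⟩
      sum0 (suc n) g + g (suc n)
        ≡⟨ cong₂ _+_ (binomial n x) (cong (λ c → ι c * x ^ℚ suc n) (k>n⇒nCk≡0 (ℕP.n<1+n n))) ⟩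
      P + 0ℚ * x ^ℚ suc n
        ≡⟨ cong (P +_) (ℚP.*-zeroˡ (x ^ℚ suc n)) ⟩
      P + 0ℚ                                  ∎

  binomial-truncated : ∀ n x → sum0 (suc n) (λ k → ι (suc n C k) * x ^ℚ k) ≡ (1ℚ + x) ^ℚ suc n - x ^ℚ suc n
  binomial-truncated n x = begin
    A
      ≡⟨ solve 2 (λ A y → A := (A :+ con 1ℚ :* y) :- y) refl A (x ^ℚ suc n) ⟩
    (A + 1ℚ * x ^ℚ suc n) - x ^ℚ suc n
      ≡⟨ cong (λ c → (A + ι c * x ^ℚ suc n) - x ^ℚ suc n) (sym (nCn≡1 (suc n))) ⟩
    sum0 (suc (suc n)) (λ k → ι (suc n C k) * x ^ℚ k) - x ^ℚ suc n
      ≡⟨ cong (_- x ^ℚ suc n) (binomial (suc n) x) ⟩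
    (1ℚ + x) ^ℚ suc n - x ^ℚ suc n       ∎
    where
    open ≡-Reasoning
    A = sum0 (suc n) (λ k → ι (suc n C k) * x ^ℚ k)

  binomial-difference : ∀ n j → sum0 (suc n) (λ k → ι (suc n C k) * ι j ^ℚ k) ≡ ι (suc j) ^ℚ suc n - ι j ^ℚ suc n
  binomial-difference n j = trans (binomial-truncated n (ι j)) (cong (λ z → z ^ℚ suc n - ι j ^ℚ suc n) (sym (ι-suc j)))

  -- The Bernoulli recurrence

  last-snoc : ∀ xs (y : ℚ) → last (snoc xs y) ≡ y
  last-snoc []            y = refl
  last-snoc (x ∷ [])      y = refl
  last-snoc (x ∷ x′ ∷ xs) y = last-snoc (x′ ∷ xs) y

  length-snoc : ∀ xs (y : ℚ) → length (snoc xs y) ≡ suc (length xs)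
  length-snoc []       y = refl
  length-snoc (x ∷ xs) y = cong suc (length-snoc xs y)

  bernoulliList-snoc : ∀ n → bernoulliList (suc n) ≡ snoc (bernoulliList n) (B n)
  bernoulliList-snoc zero    = refl
  bernoulliList-snoc (suc n) = cong (snoc (bernoulliList (suc n))) (sym (last-snoc (bernoulliList (suc n)) _))

  length-bernoulliList : ∀ n → length (bernoulliList n) ≡ n
  length-bernoulliList zero    = refl
  length-bernoulliList (suc n) = begin
    length (bernoulliList (suc n))              ≡⟨ cong length (bernoulliList-snoc n) ⟩
    length (snoc (bernoulliList n) (B n))       ≡⟨ length-snoc (bernoulliList n) (B n) ⟩
    suc (length (bernoulliList n))              ≡⟨ cong suc (length-bernoulliList n) ⟩
    suc n                                       ∎
    where open ≡-Reasoning

  binSum-snoc : ∀ M k xs y → binSum M k (snoc xs y) ≡ binSum M k xs + ι (M C (k ℕ.+ length xs)) * y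
  binSum-snoc M k []       y = begin
    ι (M C k) * y + 0ℚ              ≡⟨ solve 1 (λ z → z :+ con 0ℚ := con 0ℚ :+ z) refl (ι (M C k) * y) ⟩
    0ℚ + ι (M C k) * y              ≡⟨ cong (λ i → 0ℚ + ι (M C i) * y) (sym (ℕP.+-identityʳ k)) ⟩
    0ℚ + ι (M C (k ℕ.+ 0)) * y      ∎
    where open ≡-Reasoning
  binSum-snoc M k (x ∷ xs) y = begin
    ι (M C k) * x + binSum M (suc k) (snoc xs y)
      ≡⟨ cong (ι (M C k) * x +_) (binSum-snoc M (suc k) xs y) ⟩
    ι (M C k) * x + (binSum M (suc k) xs + ι (M C (suc k ℕ.+ length xs)) * y)
      ≡⟨ sym (ℚP.+-assoc (ι (M C k) * x) (binSum M (suc k) xs) _) ⟩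
    ι (M C k) * x + binSum M (suc k) xs + ι (M C (suc k ℕ.+ length xs)) * y
      ≡⟨ cong (λ i → ι (M C k) * x + binSum M (suc k) xs + ι (M C i) * y) (sym (ℕP.+-suc k (length xs))) ⟩
    ι (M C k) * x + binSum M (suc k) xs + ι (M C (k ℕ.+ suc (length xs))) * y ∎
    where open ≡-Reasoning

  binSum≡sum0 : ∀ M n → binSum M 0 (bernoulliList n) ≡ sum0 n (λ k → ι (M C k) * B k)
  binSum≡sum0 M zero    = refl
  binSum≡sum0 M (suc n) = begin
    binSum M 0 (bernoulliList (suc n))                          ≡⟨ cong (binSum M 0) (bernoulliList-snoc n) ⟩
    binSum M 0 (snoc (bernoulliList n) (B n))                   ≡⟨ binSum-snoc M 0 (bernoulliList n) (B n) ⟩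
    binSum M 0 (bernoulliList n) + ι (M C length (bernoulliList n)) * B n
      ≡⟨ cong₂ (λ s l → s + ι (M C l) * B n) (binSum≡sum0 M n) (length-bernoulliList n) ⟩
    sum0 n (λ k → ι (M C k) * B k) + ι (M C n) * B n            ∎
    where open ≡-Reasoning

  [1+n]Cn≡1+n : ∀ n → suc n C n ≡ suc n
  [1+n]Cn≡1+n n = trans (nCk≡nC[n∸k] (ℕP.n≤1+n n)) (trans (cong (suc n C_) (ℕP.m+n∸n≡m 1 n)) (nC1≡n (suc n)))

  bernoulli-recurrence : ∀ n → sum0 (suc (suc n)) (λ k → ι (suc (suc n) C k) * B k) ≡ 0ℚ
  bernoulli-recurrence n = begin
    sum0 (suc n) (λ k → ι (M C k) * B k) + ι (M C suc n) * B (suc n)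
      ≡⟨ cong₂ (λ s c → s + ι c * B (suc n)) (sym (binSum≡sum0 M (suc n))) ([1+n]Cn≡1+n (suc n)) ⟩
    X + ι M * B (suc n)
      ≡⟨ cong (λ b → X + ι M * b) (last-snoc (bernoulliList (suc n)) (- (inv-suc (suc n) * X))) ⟩
    X + ι M * (- (inv-suc (suc n) * X))
      ≡⟨ solve 3 (λ X c y → X :+ c :* (:- y) := X :- c :* y) refl X (ι M) (inv-suc (suc n) * X) ⟩
    X - ι M * (inv-suc (suc n) * X)
      ≡⟨ cong (λ z → X - z) (ι-suc-cancel (suc n) X) ⟩
    X - X
      ≡⟨ ℚP.+-inverseʳ X ⟩
    0ℚ ∎
    where
    open ≡-Reasoning
    M = suc (suc n)
    X = binSum M 0 (bernoulliList (suc n))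

  H≡sum1 : ∀ n → H n ≡ sum1 n (λ j → inv-suc (j ∸ 1))
  H≡sum1 zero    = refl
  H≡sum1 (suc n) = cong (_+ inv-suc n) (H≡sum1 n)

  -- Rationals modulo the prime p = N + 1.  A bound k < N below says k + 1 < p.

  module ModuloPrime (N : ℕ) (p-prime : Prime (suc N)) where

    p : ℕ
    p = suc N

    record Null (x : ℚ) : Set where
      constructor mkNull
      field p∣numerator : p ∣ ℤ.∣ ↥ x ∣
    open Null public

    record Integral (x : ℚ) : Set where
      constructor mkIntegral
      field p∤denominator : ¬ (p ∣ ↧ₙ x)
    open Integral public

    p≢1 : p ≢ 1
    p≢1 p≡1 = ¬prime[1] (subst Prime p≡1 p-prime)

    p∤1 : ¬ (p ∣ 1)
    p∤1 p∣1 = p≢1 (ℕD.∣1⇒≡1 p∣1)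

    p∤* : ∀ {m n} → ¬ (p ∣ m) → ¬ (p ∣ n) → ¬ (p ∣ m ℕ.* n)
    p∤* {m} {n} p∤m p∤n p∣mn with euclidsLemma m n p-prime p∣mn
    ... | inj₁ p∣m = p∤m p∣m
    ... | inj₂ p∣n = p∤n p∣n

    ∣ᵤ⇒∣ : ∀ {i} → p ∣ ℤ.∣ i ∣ → ℤ.+ p ℤS.∣ i
    ∣ᵤ⇒∣ = ℤS.∣ᵤ⇒∣

    ∣⇒∣ᵤ : ∀ {i} → ℤ.+ p ℤS.∣ i → p ∣ ℤ.∣ i ∣
    ∣⇒∣ᵤ = ℤS.∣⇒∣ᵤ

    -- Representations x = n / d that need not be reduced (↥ x * g = n, ↧ x * g = d):
    -- if p ∤ d then x is p-integral, and x ≡ 0 as soon as p ∣ n.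
    ∣factor⇒∣d : ∀ x {g d : ℤ.ℤ} → ↧ x ℤ.* g ≡ d → ∀ {q} → q ∣ ↧ₙ x ⊎ q ∣ ℤ.∣ g ∣ → q ∣ ℤ.∣ d ∣
    ∣factor⇒∣d x {g} den q∣factor =
      subst (_ ∣_) (trans (sym (ℤP.abs-* (↧ x) g)) (cong ℤ.∣_∣ den)) (divides-product q∣factor)
      where
      divides-product : ∀ {q} → q ∣ ↧ₙ x ⊎ q ∣ ℤ.∣ g ∣ → q ∣ ↧ₙ x ℕ.* ℤ.∣ g ∣
      divides-product (inj₁ q∣↧x) = ℕD.∣m⇒∣m*n ℤ.∣ g ∣ q∣↧x
      divides-product (inj₂ q∣g)  = ℕD.∣n⇒∣m*n (↧ₙ x) q∣g

    integral-fraction : ∀ x {g d : ℤ.ℤ} → ↧ x ℤ.* g ≡ d → ¬ (p ∣ ℤ.∣ d ∣) → Integral x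
    integral-fraction x den p∤d = mkIntegral λ p∣↧x → p∤d (∣factor⇒∣d x den (inj₁ p∣↧x))

    null-fraction : ∀ x {g n d : ℤ.ℤ} → ↥ x ℤ.* g ≡ n → ↧ x ℤ.* g ≡ d → ¬ (p ∣ ℤ.∣ d ∣) → p ∣ ℤ.∣ n ∣ → Null x
    null-fraction x {g} num den p∤d p∣n
      with euclidsLemma ℤ.∣ ↥ x ∣ ℤ.∣ g ∣ p-prime
             (subst (p ∣_) (trans (cong ℤ.∣_∣ (sym num)) (ℤP.abs-* (↥ x) g)) p∣n)
    ... | inj₁ p∣↥x = mkNull p∣↥x
    ... | inj₂ p∣g  = ⊥-elim (p∤d (∣factor⇒∣d x den (inj₂ p∣g)))

    -- numerator and denominator of a reduced fraction are coprime
    null⇒integral : ∀ {x} → Null x → Integral x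
    null⇒integral {ℚ.mkℚ _ _ coprime} (mkNull p∣n) = mkIntegral λ p∣d → p≢1 (Coprime.recompute coprime (p∣n , p∣d))

    integral-+ : ∀ {x y} → Integral x → Integral y → Integral (x + y)
    integral-+ {x} {y} ix iy = integral-fraction (x + y) (ℚP.↧-+ x y) (p∤* (p∤denominator ix) (p∤denominator iy))

    integral-* : ∀ {x y} → Integral x → Integral y → Integral (x * y)
    integral-* {x} {y} ix iy = integral-fraction (x * y) (ℚP.↧-* x y) (p∤* (p∤denominator ix) (p∤denominator iy))

    integral-neg : ∀ {x} → Integral x → Integral (- x)
    integral-neg {x} ix = mkIntegral λ p∣↧-x → p∤denominator ix (subst (p ∣_) (cong ℤ.∣_∣ (ℚP.↧-neg x)) p∣↧-x)

    null-+ : ∀ {x y} → Null x → Null y → Null (x + y)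
    null-+ {x} {y} zx zy =
      null-fraction (x + y) (ℚP.↥-+ x y) (ℚP.↧-+ x y)
        (p∤* (p∤denominator (null⇒integral zx)) (p∤denominator (null⇒integral zy)))
        (∣⇒∣ᵤ (ℤS.∣m∣n⇒∣m+n (ℤS.∣m⇒∣m*n (↧ y) (∣ᵤ⇒∣ {↥ x} (p∣numerator zx)))
                                (ℤS.∣m⇒∣m*n (↧ x) (∣ᵤ⇒∣ {↥ y} (p∣numerator zy)))))

    null-*ʳ : ∀ {x y} → Null x → Integral y → Null (x * y)
    null-*ʳ {x} {y} zx iy =
      null-fraction (x * y) (ℚP.↥-* x y) (ℚP.↧-* x y)
        (p∤* (p∤denominator (null⇒integral zx)) (p∤denominator iy))
        (∣⇒∣ᵤ (ℤS.∣m⇒∣m*n (↥ y) (∣ᵤ⇒∣ {↥ x} (p∣numerator zx))))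

    null-*ˡ : ∀ {x y} → Integral x → Null y → Null (x * y)
    null-*ˡ {x} {y} ix zy = subst Null (ℚP.*-comm y x) (null-*ʳ zy ix)

    null-neg : ∀ {x} → Null x → Null (- x)
    null-neg {x} zx =
      mkNull (subst (p ∣_) (trans (sym (ℤP.∣-i∣≡∣i∣ (↥ x))) (cong ℤ.∣_∣ (sym (ℚP.↥-neg x)))) (p∣numerator zx))

    null-- : ∀ {x y} → Null x → Null y → Null (x - y)
    null-- zx zy = null-+ zx (null-neg zy)

    null-0 : Null 0ℚ
    null-0 = mkNull (p ℕD.∣0)

    integral-ι : ∀ n → Integral (ι n)
    integral-ι n = integral-fraction (ι n) (ℚP.↧-/ (ℤ.+ n) 1) p∤1

    integral-pow : ∀ {x} e → Integral x → Integral (x ^ℚ e)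
    integral-pow zero    ix = integral-ι 1
    integral-pow (suc e) ix = integral-* ix (integral-pow e ix)

    null-ι-p : Null (ι p)
    null-ι-p = null-fraction (ι p) (ℚP.↥-/ (ℤ.+ p) 1) (ℚP.↧-/ (ℤ.+ p) 1) p∤1 ℕD.∣-refl

    integral-inv-suc : ∀ k → k ℕ.< N → Integral (inv-suc k)
    integral-inv-suc k k<N = integral-fraction (inv-suc k) (ℚP.↧-/ (ℤ.+ 1) (suc k))
                               λ p∣1+k → ℕP.<⇒≱ (s≤s k<N) (ℕD.∣⇒≤ p∣1+k)

    null-sum0 : ∀ n {f : ℕ → ℚ} → (∀ i → i ℕ.< n → Null (f i)) → Null (sum0 n f)
    null-sum0 zero    z = null-0
    null-sum0 (suc n) z = null-+ (null-sum0 n (λ i i<n → z i (ℕP.m<n⇒m<1+n i<n))) (z n ℕP.≤-refl)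

    null-sum1 : ∀ n {f : ℕ → ℚ} → (∀ i → i ℕ.< n → Null (f (suc i))) → Null (sum1 n f)
    null-sum1 zero    z = null-0
    null-sum1 (suc n) z = null-+ (null-sum1 n (λ i i<n → z i (ℕP.m<n⇒m<1+n i<n))) (z n ℕP.≤-refl)

    null-cancel : ∀ k {x} → k ℕ.< N → Null (ι (suc k) * x) → Null x
    null-cancel k {x} k<N z = subst Null cancelled (null-*ˡ (integral-inv-suc k k<N) z)
      where
      cancelled : inv-suc k * (ι (suc k) * x) ≡ x
      cancelled = trans (solve 3 (λ i c x → i :* (c :* x) := c :* (i :* x)) refl (inv-suc k) (ι (suc k)) x)
                        (ι-suc-cancel k x)

    -- x ≡ y (mod p); the field is literally the relation x ≡ y [modℚ p] of Defs
    infix 4 _≈_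
    record _≈_ (x y : ℚ) : Set where
      constructor mk≈
      field null-difference : Null (x - y)
    open _≈_ public

    ≈-refl : ∀ {x} → x ≈ x
    ≈-refl {x} = mk≈ (subst Null (sym (ℚP.+-inverseʳ x)) null-0)

    ≈-trans : ∀ {x y z} → x ≈ y → y ≈ z → x ≈ z
    ≈-trans {x} {y} {z} (mk≈ x-y) (mk≈ y-z) =
      mk≈ (subst Null (solve 3 (λ x y z → (x :- y) :+ (y :- z) := x :- z) refl x y z) (null-+ x-y y-z))

    ≡⇒≈ : ∀ {x y} → x ≡ y → x ≈ y
    ≡⇒≈ refl = ≈-refl

    null⇒≈0 : ∀ {x} → Null x → x ≈ 0ℚ
    null⇒≈0 {x} z = mk≈ (subst Null (sym (ℚP.+-identityʳ x)) z)

    -- products of congruences; the two p-integrality conditions make the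
    -- difference a·c - b·d = a·(c - d) + (a - b)·d null
    *-≈ : ∀ {a b c d} → Integral a → Integral d → a ≈ b → c ≈ d → a * c ≈ b * d
    *-≈ {a} {b} {c} {d} ia id (mk≈ a-b) (mk≈ c-d) =
      mk≈ (subst Null (solve 4 (λ a b c d → a :* (c :- d) :+ (a :- b) :* d := a :* c :- b :* d) refl a b c d)
                      (null-+ (null-*ˡ ia c-d) (null-*ʳ a-b id)))

    pow-≈ : ∀ {x y} e → Integral x → Integral y → x ≈ y → x ^ℚ e ≈ y ^ℚ e
    pow-≈ zero    ix iy x≈y = ≈-refl
    pow-≈ (suc e) ix iy x≈y = *-≈ ix (integral-pow e iy) x≈y (pow-≈ e ix iy x≈y)

    sum1-≈ : ∀ n {f g : ℕ → ℚ} → (∀ i → i ℕ.< n → f (suc i) ≈ g (suc i)) → sum1 n f ≈ sum1 n g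
    sum1-≈ n {f} {g} f≈g = mk≈ (subst Null (sum1-- n f g) (null-sum1 n (λ i i<n → null-difference (f≈g i i<n))))

    -- 1/a + 1/b ≡ 0 when a + b = p, since 1/a + 1/b = (a + b)/(ab)
    null-inverse-pair : ∀ a b → suc a ℕ.+ suc b ≡ p → Null (inv-suc a + inv-suc b)
    null-inverse-pair a b a+b≡p =
      subst Null (sym combined) (null-*ˡ (integral-* (integral-inv-suc a a<N) (integral-inv-suc b b<N))
                                         (subst Null (sym sum≡p) null-ι-p))
      where
      open ≡-Reasoning
      below-N : ∀ a b → suc a ℕ.+ suc b ≡ p → a ℕ.< N
      below-N a b eq = subst (a ℕ.<_) (ℕP.suc-injective eq) (ℕP.m<m+n a (s≤s z≤n))
      a<N = below-N a b a+b≡p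
      b<N = below-N b a (trans (ℕP.+-comm (suc b) (suc a)) a+b≡p)
      sum≡p : ι (suc a) + ι (suc b) ≡ ι p
      sum≡p = trans (sym (ι-+ (suc a) (suc b))) (cong ι a+b≡p)
      combined : inv-suc a + inv-suc b ≡ (inv-suc a * inv-suc b) * (ι (suc a) + ι (suc b))
      combined = begin
        inv-suc a + inv-suc b
          ≡⟨ solve 2 (λ u v → u :+ v := v :* con 1ℚ :+ u :* con 1ℚ) refl (inv-suc a) (inv-suc b) ⟩
        inv-suc b * 1ℚ + inv-suc a * 1ℚ
          ≡⟨ cong₂ (λ s t → inv-suc b * s + inv-suc a * t) (sym (ι-suc*inv-suc a)) (sym (ι-suc*inv-suc b)) ⟩
        inv-suc b * (ι (suc a) * inv-suc a) + inv-suc a * (ι (suc b) * inv-suc b)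
          ≡⟨ solve 4 (λ u v x y → v :* (x :* u) :+ u :* (y :* v) := (u :* v) :* (x :+ y)) refl
                     (inv-suc a) (inv-suc b) (ι (suc a)) (ι (suc b)) ⟩
        (inv-suc a * inv-suc b) * (ι (suc a) + ι (suc b)) ∎

    -- Uniqueness for the binomial recurrence: if Σ_{k≤n} C(n+1,k) d_k ≡ 0 for all
    -- n < N, then d_n ≡ 0 for all n < N (the last term is (n+1)·d_n, and n + 1 < p).
    binomial-recurrence-null : (d : ℕ → ℚ) →
      (∀ n → n ℕ.< N → Null (sum0 (suc n) (λ k → ι (suc n C k) * d k))) →
      ∀ n → n ℕ.< N → Null (d n)
    binomial-recurrence-null d recurrence n n<N = below (suc n) n<N n ℕP.≤-refl
      where
      step : ∀ n → n ℕ.< N → (∀ k → k ℕ.< n → Null (d k)) → Null (d n)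
      step n n<N earlier-null = null-cancel n n<N (subst (λ c → Null (ι c * d n)) ([1+n]Cn≡1+n n) last-null)
        where
        earlier = sum0 n (λ k → ι (suc n C k) * d k)
        last-null : Null (ι (suc n C n) * d n)
        last-null = subst Null (solve 2 (λ e y → (e :+ y) :- e := y) refl earlier (ι (suc n C n) * d n))
          (null-- (recurrence n n<N) (null-sum0 n (λ k k<n → null-*ˡ (integral-ι (suc n C k)) (earlier-null k k<n))))
      below : ∀ m → m ℕ.≤ N → ∀ k → k ℕ.< m → Null (d k)
      below (suc m) sm≤N k k<sm with ℕP.m<1+n⇒m<n∨m≡n k<sm
      ... | inj₁ k<m  = below m (ℕP.<⇒≤ sm≤N) k k<m
      ... | inj₂ refl = step k sm≤N (below k (ℕP.<⇒≤ sm≤N))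

  -- Harmonic and power sums modulo an odd prime p = N + 1

  module HarmonicCongruences (N : ℕ) (p-prime : Prime (suc N)) (1<N : 1 ℕ.< N) where
    open ModuloPrime N p-prime

    integral-H : ∀ k → k ℕ.≤ N → Integral (H k)
    integral-H zero    _     = integral-ι 0
    integral-H (suc k) 1+k≤N = integral-+ (integral-H k (ℕP.<⇒≤ 1+k≤N)) (integral-inv-suc k 1+k≤N)

    suc[N∸1+i]≡N∸i : ∀ {i} → i ℕ.< N → suc (N ∸ suc i) ≡ N ∸ i
    suc[N∸1+i]≡N∸i i<N = sym (ℕP.+-∸-assoc 1 i<N)

    complement : ∀ i → i ℕ.< N → suc i ℕ.+ suc (N ∸ suc i) ≡ p
    complement i i<N = cong suc (trans (cong (i ℕ.+_) (suc[N∸1+i]≡N∸i i<N)) (ℕP.m+[n∸m]≡n (ℕP.<⇒≤ i<N)))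

    -- Wolstenholme's congruence in its weakest form: H_{p-1} ≡ 0, because
    -- 2 H_{p-1} = Σ_i (1/i + 1/(p-i)) and 2 is invertible
    H-N-null : Null (H N)
    H-N-null = null-cancel 1 1<N (subst Null twice (null-sum1 N pairs))
      where
      open ≡-Reasoning
      v : ℕ → ℚ
      v j = inv-suc (j ∸ 1)
      pairs : ∀ i → i ℕ.< N → Null (v (suc i) + v (p ∸ suc i))
      pairs i i<N = subst (λ j → Null (inv-suc i + inv-suc j)) (sym N∸i∸1≡N∸[1+i])
                          (null-inverse-pair i (N ∸ suc i) (complement i i<N))
        where
        N∸i∸1≡N∸[1+i] : N ∸ i ∸ 1 ≡ N ∸ suc i
        N∸i∸1≡N∸[1+i] = trans (ℕP.∸-+-assoc N i 1) (cong (N ∸_) (ℕP.+-comm i 1))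
      twice : sum1 N (λ i → v i + v (p ∸ i)) ≡ ι 2 * H N
      twice = begin
        sum1 N (λ i → v i + v (p ∸ i))          ≡⟨ sum1-+ N v (λ i → v (p ∸ i)) ⟩
        sum1 N v + sum1 N (λ i → v (p ∸ i))     ≡⟨ cong (sum1 N v +_) (sym (sum1-reflect N v)) ⟩
        sum1 N v + sum1 N v                     ≡⟨ cong (λ h → h + h) (sym (H≡sum1 N)) ⟩
        H N + H N                               ≡⟨ solve 1 (λ h → h :+ h := con (ι 2) :* h) refl (H N) ⟩
        ι 2 * H N                               ∎

    -- reflection H_{N-k} ≡ H_k: going from k to k + 1 removes 1/(N-k) on the left and
    -- adds 1/(k+1) on the right, and these two are opposite modulo p
    H-reflect : ∀ k → k ℕ.≤ N → H (N ∸ k) ≈ H k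
    H-reflect zero    _     = null⇒≈0 H-N-null
    H-reflect (suc k) 1+k≤N = mk≈ (subst Null rearranged
      (null-- (subst (λ h → Null (h - H k)) (cong H (sym (suc[N∸1+i]≡N∸i 1+k≤N)))
                     (null-difference (H-reflect k (ℕP.<⇒≤ 1+k≤N))))
              (null-inverse-pair k (N ∸ suc k) (complement k 1+k≤N))))
      where
      rearranged : (H (N ∸ suc k) + inv-suc (N ∸ suc k) - H k) - (inv-suc k + inv-suc (N ∸ suc k))
                   ≡ H (N ∸ suc k) - H (suc k)
      rearranged = solve 4 (λ A w h v → (A :+ w :- h) :- (v :+ w) := A :- (h :+ v)) refl
                           (H (N ∸ suc k)) (inv-suc (N ∸ suc k)) (H k) (inv-suc k)

    S : ℕ → ℚ
    S e = sum1 N (λ j → ι j ^ℚ e)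

    -- Σ_{i≤n} C(n+1,i) S_i = p^{n+1} - 1, by expanding the telescoping sum Σ_j ((j+1)^{n+1} - j^{n+1})
    S-binomial : ∀ n → sum0 (suc n) (λ i → ι (suc n C i) * S i) ≡ ι p ^ℚ suc n - 1ℚ
    S-binomial n = begin
      sum0 (suc n) (λ i → c i * S i)
        ≡⟨ sum0-cong (suc n) (λ i _ → sum1-*ˡ N (c i) (λ j → ι j ^ℚ i)) ⟩
      sum0 (suc n) (λ i → sum1 N (λ j → c i * ι j ^ℚ i))
        ≡⟨ sum0-sum1-swap (suc n) N (λ i j → c i * ι j ^ℚ i) ⟩
      sum1 N (λ j → sum0 (suc n) (λ i → c i * ι j ^ℚ i))
        ≡⟨ sum1-cong N (λ j _ → binomial-difference n (suc j)) ⟩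
      sum1 N (λ j → a (suc j) - a j)
        ≡⟨ sum1-telescope N a ⟩
      a p - a 1
        ≡⟨ cong (λ z → a p - z) (1-pow (suc n)) ⟩
      ι p ^ℚ suc n - 1ℚ                                        ∎
      where
      open ≡-Reasoning
      c : ℕ → ℚ
      c i = ι (suc n C i)
      a : ℕ → ℚ
      a j = ι j ^ℚ suc n

    null-p-pow : ∀ n → Null (ι p ^ℚ suc n)
    null-p-pow n = null-*ʳ null-ι-p (integral-pow n (integral-ι p))

    -- S_e ≡ 0 for 1 ≤ e < N: apply the uniqueness lemma to S_0 + 1 = p, S_1, S_2, …
    S-null : ∀ e → suc e ℕ.< N → Null (S (suc e))
    S-null e 1+e<N = binomial-recurrence-null d recurrence (suc e) 1+e<N
      where
      d : ℕ → ℚ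
      d zero    = S 0 + 1ℚ
      d (suc k) = S (suc k)
      recurrence : ∀ n → n ℕ.< N → Null (sum0 (suc n) (λ k → ι (suc n C k) * d k))
      recurrence n _ = subst Null (sym shifted) (null-p-pow n)
        where
        open ≡-Reasoning
        c : ℕ → ℚ
        c k = ι (suc n C k)
        rest = sum0 n (λ k → c (suc k) * S (suc k))
        shifted : sum0 (suc n) (λ k → c k * d k) ≡ ι p ^ℚ suc n
        shifted = begin
          sum0 (suc n) (λ k → c k * d k)
            ≡⟨ sum0-first n (λ k → c k * d k) ⟩
          c 0 * (S 0 + 1ℚ) + rest
            ≡⟨ solve 3 (λ c s r → c :* (s :+ con 1ℚ) :+ r := (c :* s :+ r) :+ c) refl (c 0) (S 0) rest ⟩
          (c 0 * S 0 + rest) + c 0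
            ≡⟨ cong (_+ c 0) (sym (sum0-first n (λ k → c k * S k))) ⟩
          sum0 (suc n) (λ k → c k * S k) + 1ℚ
            ≡⟨ cong (_+ 1ℚ) (S-binomial n) ⟩
          (ι p ^ℚ suc n - 1ℚ) + 1ℚ
            ≡⟨ solve 1 (λ x → (x :- con 1ℚ) :+ con 1ℚ := x) refl (ι p ^ℚ suc n) ⟩
          ι p ^ℚ suc n                         ∎

    T : ℕ → ℚ
    T s = sum1 N (λ j → ι j ^ℚ s * H j)

    -- Σ_{k≤n} C(n+1,k) T_k = p^{n+1} H_N - S_n: the binomial theorem turns the left side
    -- into Σ_j ((j+1)^{n+1} - j^{n+1}) H_j, and Abel summation with H_j - H_{j-1} = 1/j
    -- finishes the computation
    T-binomial : ∀ n → sum0 (suc n) (λ k → ι (suc n C k) * T k) ≡ ι p ^ℚ suc n * H N - S n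
    T-binomial n = begin
      sum0 (suc n) (λ k → c k * T k)
        ≡⟨ sum0-cong (suc n) (λ k _ → sum1-*ˡ N (c k) (λ j → ι j ^ℚ k * H j)) ⟩
      sum0 (suc n) (λ k → sum1 N (λ j → c k * (ι j ^ℚ k * H j)))
        ≡⟨ sum0-sum1-swap (suc n) N (λ k j → c k * (ι j ^ℚ k * H j)) ⟩
      sum1 N (λ j → sum0 (suc n) (λ k → c k * (ι j ^ℚ k * H j)))
        ≡⟨ sum1-cong N (λ i _ → expand (suc i)) ⟩
      sum1 N (λ j → (a (suc j) - a j) * H j)
        ≡⟨ sum1-abel N a H refl ⟩
      a p * H N - sum1 N (λ j → a j * (H j - H (j ∸ 1)))
        ≡⟨ cong (λ z → a p * H N - z) (sum1-cong N increment) ⟩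
      ι p ^ℚ suc n * H N - S n                                        ∎
      where
      open ≡-Reasoning
      c : ℕ → ℚ
      c k = ι (suc n C k)
      a : ℕ → ℚ
      a j = ι j ^ℚ suc n
      expand : ∀ j → sum0 (suc n) (λ k → c k * (ι j ^ℚ k * H j)) ≡ (a (suc j) - a j) * H j
      expand j = begin
        sum0 (suc n) (λ k → c k * (ι j ^ℚ k * H j))
          ≡⟨ sum0-cong (suc n) (λ k _ → sym (ℚP.*-assoc (c k) (ι j ^ℚ k) (H j))) ⟩
        sum0 (suc n) (λ k → c k * ι j ^ℚ k * H j)
          ≡⟨ sym (sum0-*ʳ (suc n) (H j) (λ k → c k * ι j ^ℚ k)) ⟩
        sum0 (suc n) (λ k → c k * ι j ^ℚ k) * H j
          ≡⟨ cong (_* H j) (binomial-difference n j) ⟩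
        (a (suc j) - a j) * H j                       ∎
      increment : ∀ i → i ℕ.< N → a (suc i) * (H (suc i) - H i) ≡ ι (suc i) ^ℚ n
      increment i _ = begin
        ι (suc i) * ι (suc i) ^ℚ n * ((H i + inv-suc i) - H i)
          ≡⟨ solve 4 (λ x y h v → x :* y :* ((h :+ v) :- h) := y :* (x :* (v :* con 1ℚ))) refl
                     (ι (suc i)) (ι (suc i) ^ℚ n) (H i) (inv-suc i) ⟩
        ι (suc i) ^ℚ n * (ι (suc i) * (inv-suc i * 1ℚ))
          ≡⟨ cong (ι (suc i) ^ℚ n *_) (ι-suc-cancel i 1ℚ) ⟩
        ι (suc i) ^ℚ n * 1ℚ
          ≡⟨ ℚP.*-identityʳ (ι (suc i) ^ℚ n) ⟩
        ι (suc i) ^ℚ n ∎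

    -- T_s ≡ B_s for s < N: the differences T_k - B_k satisfy the binomial recurrence
    -- modulo p, since p^{n+1} H_N ≡ 0, S_0 = N ≡ -1 = -B_0, and S_n ≡ 0 for n ≥ 1
    T≈B : ∀ s → s ℕ.< N → T s ≈ B s
    T≈B s s<N = mk≈ (binomial-recurrence-null (λ k → T k - B k) recurrence s s<N)
      where
      c : ℕ → ℕ → ℚ
      c n k = ι (suc n C k)
      null-pH : ∀ n → Null (ι p ^ℚ suc n * H N)
      null-pH n = null-*ʳ (null-p-pow n) (integral-H N ℕP.≤-refl)
      split : ∀ n → sum0 (suc n) (λ k → c n k * (T k - B k))
                    ≡ sum0 (suc n) (λ k → c n k * T k) - sum0 (suc n) (λ k → c n k * B k)
      split n = trans (sum0-cong (suc n) (λ k _ → solve 3 (λ c t b → c :* (t :- b) := c :* t :- c :* b) refl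
                                                            (c n k) (T k) (B k)))
                      (sum0-- (suc n) (λ k → c n k * T k) (λ k → c n k * B k))
      recurrence : ∀ n → n ℕ.< N → Null (sum0 (suc n) (λ k → c n k * (T k - B k)))
      recurrence zero    _       = subst Null (sym (trans (split 0) first)) (null-- (null-pH 0) null-ι-p)
        where
        open ≡-Reasoning
        first : sum0 1 (λ k → c 0 k * T k) - sum0 1 (λ k → c 0 k * B k) ≡ ι p ^ℚ 1 * H N - ι p
        first = begin
          sum0 1 (λ k → c 0 k * T k) - (0ℚ + 1ℚ * 1ℚ)
            ≡⟨ cong (_- (0ℚ + 1ℚ * 1ℚ)) (T-binomial 0) ⟩
          (ι p ^ℚ 1 * H N - S 0) - (0ℚ + 1ℚ * 1ℚ)
            ≡⟨ cong (λ z → (ι p ^ℚ 1 * H N - z) - (0ℚ + 1ℚ * 1ℚ)) (sum1-one N) ⟩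
          (ι p ^ℚ 1 * H N - ι N) - (0ℚ + 1ℚ * 1ℚ)
            ≡⟨ solve 2 (λ a b → (a :- b) :- (con 0ℚ :+ con 1ℚ :* con 1ℚ) := a :- (con 1ℚ :+ b)) refl (ι p ^ℚ 1 * H N) (ι N) ⟩
          ι p ^ℚ 1 * H N - (1ℚ + ι N)
            ≡⟨ cong (λ z → ι p ^ℚ 1 * H N - z) (sym (ι-suc N)) ⟩
          ι p ^ℚ 1 * H N - ι p                            ∎
      recurrence (suc n) 1+n<N =
        subst Null (sym (trans (split (suc n)) higher)) (null-- (null-pH (suc n)) (S-null n 1+n<N))
        where
        higher : sum0 (suc (suc n)) (λ k → c (suc n) k * T k) - sum0 (suc (suc n)) (λ k → c (suc n) k * B k)
                 ≡ ι p ^ℚ suc (suc n) * H N - S (suc n)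
        higher = trans (cong₂ _-_ (T-binomial (suc n)) (bernoulli-recurrence n)) (ℚP.+-identityʳ _)

    R : ℕ → ℚ
    R e = sum1 N (λ k → ι k ^ℚ e * inv-suc (k ∸ 1))

    R-suc : ∀ e → R (suc e) ≡ S e
    R-suc e = sum1-cong N λ i _ → begin
      ι (suc i) * ι (suc i) ^ℚ e * inv-suc i
        ≡⟨ solve 3 (λ x y v → x :* y :* v := y :* (x :* (v :* con 1ℚ))) refl (ι (suc i)) (ι (suc i) ^ℚ e) (inv-suc i) ⟩
      ι (suc i) ^ℚ e * (ι (suc i) * (inv-suc i * 1ℚ))
        ≡⟨ cong (ι (suc i) ^ℚ e *_) (ι-suc-cancel i 1ℚ) ⟩
      ι (suc i) ^ℚ e * 1ℚ
        ≡⟨ ℚP.*-identityʳ _ ⟩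
      ι (suc i) ^ℚ e ∎
      where open ≡-Reasoning

    -- R vanishes at even exponents: R_0 = H_N and R_{2j+2} = S_{2j+1}
    R-even-null : ∀ j → suc (2 ℕ.* j) ℕ.< N → Null (R (2 ℕ.* j))
    R-even-null zero    _   = subst Null (trans (H≡sum1 N) (sum1-cong N (λ i _ → sym (ℚP.*-identityˡ _)))) H-N-null
    R-even-null (suc j) m<N =
      subst Null (sym R≡S) (S-null (2 ℕ.* j) (ℕP.<-trans (ℕP.n<1+n _) (ℕP.<-trans (ℕP.n<1+n _) m<N′)))
      where
      m<N′ : suc (suc (suc (2 ℕ.* j))) ℕ.< N
      m<N′ = subst (λ e → suc e ℕ.< N) (ℕP.*-suc 2 j) m<N
      R≡S : R (2 ℕ.* suc j) ≡ S (suc (2 ℕ.* j))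
      R≡S = trans (cong R (ℕP.*-suc 2 j)) (R-suc (suc (2 ℕ.* j)))

    U : ℕ → ℚ
    U m = sum1 N (λ k → ι k ^ℚ m * (H k * H k))

    module _ (j : ℕ) (m<N : suc (2 ℕ.* j) ℕ.< N) where
      private
        e = 2 ℕ.* j
        m = suc e

      f : ℕ → ℚ
      f k = ι k ^ℚ m * (H k * H k)

      -- the summand of U after the substitution k ↦ p - k; for i < N the index
      -- p - (i + 1) = N - i satisfies N - i ≡ -(i+1), and m is odd
      f-reflected : ∀ i → i ℕ.< N → f (N ∸ i) ≈ - (ι (suc i) ^ℚ m) * (H i * H i)
      f-reflected i i<N =
        *-≈ (integral-pow m (integral-ι (N ∸ i))) (integral-* (integral-H i i≤N) (integral-H i i≤N)) power
            (*-≈ (integral-H (N ∸ i) (ℕP.m∸n≤m N i)) (integral-H i i≤N) (H-reflect i i≤N) (H-reflect i i≤N))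
        where
        i≤N = ℕP.<⇒≤ i<N
        N∸i+1+i≡p : N ∸ i ℕ.+ suc i ≡ p
        N∸i+1+i≡p = trans (ℕP.+-suc (N ∸ i) i) (cong suc (ℕP.m∸n+n≡m i≤N))
        base : ι (N ∸ i) ≈ - ι (suc i)
        base = mk≈ (subst Null (trans (cong ι (sym N∸i+1+i≡p)) (trans (ι-+ (N ∸ i) (suc i))
                      (solve 2 (λ a b → a :+ b := a :- (:- b)) refl (ι (N ∸ i)) (ι (suc i))))) null-ι-p)
        power : ι (N ∸ i) ^ℚ m ≈ - (ι (suc i) ^ℚ m)
        power = ≈-trans (pow-≈ m (integral-ι (N ∸ i)) (integral-neg (integral-ι (suc i))) base)
                        (≡⇒≈ (neg-pow-odd j (ι (suc i))))

      -- the expansion -k^m H_{k-1}² = 2 k^{m-1} H_k - k^{m-1}/k - k^m H_k², from H_{k-1} = H_k - 1/k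
      g : ℕ → ℚ
      g k = (ι 2 * (ι k ^ℚ e * H k) - ι k ^ℚ e * inv-suc (k ∸ 1)) - f k

      expand-square : ∀ i → - (ι (suc i) ^ℚ m) * (H i * H i) ≡ g (suc i)
      expand-square i = begin
        - (x * y) * (h * h)        ≡⟨ solve 4 (λ x y h v → :- (x :* y) :* (h :* h)
                                                := ((con (ι 2) :* (y :* (h :+ v)) :- y :* v) :- (x :* y) :* ((h :+ v) :* (h :+ v)))
                                                   :- (con 1ℚ :- x :* v) :* (con (ι 2) :* y :* h :+ y :* v))
                                           refl x y h v ⟩
        G - (1ℚ - x * v) * s       ≡⟨ cong (λ z → G - (1ℚ - z) * s) (ι-suc*inv-suc i) ⟩
        G - (1ℚ - 1ℚ) * s          ≡⟨ solve 2 (λ G s → G :- (con 1ℚ :- con 1ℚ) :* s := G) refl G s ⟩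
        G                          ∎
        where
        open ≡-Reasoning
        x = ι (suc i)
        y = x ^ℚ e
        h = H i
        v = inv-suc i
        G = (ι 2 * (y * (h + v)) - y * v) - (x * y) * ((h + v) * (h + v))
        s = ι 2 * y * h + y * v

      sum-g : sum1 N g ≡ (ι 2 * T e - R e) - U m
      sum-g = begin
        sum1 N g
          ≡⟨ sum1-- N double-minus f ⟩
        sum1 N double-minus - U m
          ≡⟨ cong (_- U m) (sum1-- N (λ k → ι 2 * (ι k ^ℚ e * H k)) (λ k → ι k ^ℚ e * inv-suc (k ∸ 1))) ⟩
        (sum1 N (λ k → ι 2 * (ι k ^ℚ e * H k)) - R e) - U m
          ≡⟨ cong (λ z → (z - R e) - U m) (sym (sum1-*ˡ N (ι 2) (λ k → ι k ^ℚ e * H k))) ⟩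
        (ι 2 * T e - R e) - U m                                   ∎
        where
        open ≡-Reasoning
        double-minus : ℕ → ℚ
        double-minus k = ι 2 * (ι k ^ℚ e * H k) - ι k ^ℚ e * inv-suc (k ∸ 1)

      U-reflect : U m ≈ (ι 2 * T e - R e) - U m
      U-reflect = ≈-trans (≡⇒≈ (sum1-reflect N f))
                 (≈-trans (sum1-≈ N (λ i i<N → ≈-trans (f-reflected i i<N) (≡⇒≈ (expand-square i))))
                          (≡⇒≈ sum-g))

      -- hence 2 U ≡ 2 T_{m-1} - R_{m-1} ≡ 2 B_{m-1}, and 2 is invertible
      U≈B : U m ≈ B e
      U≈B = mk≈ (null-cancel 1 1<N (subst Null combine
              (null-- (null-+ (null-difference U-reflect) (null-*ˡ (integral-ι 2) (null-difference (T≈B e e<N))))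
                      (R-even-null j m<N))))
        where
        e<N : e ℕ.< N
        e<N = ℕP.<-trans (ℕP.n<1+n e) m<N
        combine : (U m - ((ι 2 * T e - R e) - U m)) + ι 2 * (T e - B e) - R e ≡ ι 2 * (U m - B e)
        combine = solve 4 (λ u t r b → (u :- ((con (ι 2) :* t :- r) :- u)) :+ con (ι 2) :* (t :- b) :- r
                                       := con (ι 2) :* (u :- b)) refl (U m) (T e) (R e) (B e)

open HarmonicSquareSums using (module ModuloPrime; module HarmonicCongruences)
open import Data.Nat using (ℕ; zero; suc; _<_; _∸_; _+_; _*_)
open import Data.Nat.Primality using (Prime)
open import Data.Product using (∃-syntax; _,_)
open import Relation.Binary.PropositionalEquality using (_≡_; refl)
open import Data.Rational as ℚ using ()
import Data.Nat.Properties as ℕP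

-- With p = N + 1 and m = 2j + 1, the congruence U_m ≈ B_{m-1} of HarmonicCongruences
-- is, unfolded, exactly the divisibility of the numerator demanded by _≡_[modℚ_].
corollary3p3 : (p m : ℕ) → Prime p → 3 < p → (∃[ j ] m ≡ 2 * j + 1) → 0 < m → m < p ∸ 1 →
    sum1 (p ∸ 1) (λ k → (ℕtoℚ k ^ℚ m) ℚ.* (H k ℚ.* H k)) ≡ B (m ∸ 1) [modℚ p ]
corollary3p3 zero    _ _ () _ _ _
corollary3p3 (suc N) .(2 * j + 1) p-prime 3<p (j , refl) _ m<N rewrite ℕP.+-comm (2 * j) 1 =
  p∣numerator (null-difference (U≈B j m<N))
  where
  1<N : 1 < N
  1<N = ℕP.<-trans (ℕP.n<1+n 1) (ℕP.≤-pred 3<p)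
  open ModuloPrime N p-prime using (p∣numerator; null-difference)
  open HarmonicCongruences N p-prime 1<N using (U≈B)
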